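{- Let $N$ be a natural number. For any $\delta\subseteq{}^{\underline N}2$ and $Z\subseteq N$, \[\mathrm{HN}\big(L(\delta,Z)\cup R(\delta,Z)\big)=\min\{\mathrm{HN}(L(\delta,Z)),\mathrm{HN}(R(\delta,Z))\}.\]
   Context: $N$ is identified with $\{0,\ldots,N-1\}$. ${}^{\underline N}2$ is the set of all partial functions $\sigma$ with $\mathrm{dom}(\sigma)\subseteq N$ and values in $\{0,1\}$ (including the empty function). For $\sigma\in{}^{\underline N}2$ and $Z\subseteq N$, $\sigma\restriction Z=\{(a,b)\in\sigma:a\in Z\}$. $L(\delta,Z)=\{\sigma\restriction Z:\sigma\in\delta,\ |\sigma\restriction Z|\geq|\sigma\restriction(N\setminus Z)|\}$ and $R(\delta,Z)=\{\sigma\restriction(N\setminus Z):\sigma\in\delta,\ |\sigma\restriction Z|<|\sigma\restriction(N\setminus Z)|\}$. For $\delta_1,\delta_2\subseteq{}^{\underline N}2$, $\delta_1\preceq\delta_2$ iff for every $\sigma\in\delta_1$ there is $\rho\in\delta_2$ with $\rho\subseteq\sigma$. For $\delta\subseteq{}^{\underline N}2$, $\mathrm{hn}(\delta)$ is the maximum of $k+1$ over $k\in\{0,\ldots,N-1\}$ such that for every $\delta'\subseteq\delta$ there is $\delta''\subseteq\delta'$ whose elements have pairwise disjoint domains and $|\bigcup_{\sigma\in\delta''}\mathrm{dom}(\sigma)|\geq k|\delta'|$; and $\mathrm{HN}(\delta)=\max\{\mathrm{hn}(\delta'):\delta'\subseteq{}^{\underline N}2,\ \delta\preceq\delta'\}$.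 -}

module Defs where

open import Data.Nat using (ℕ; zero; suc; _*_; _≤_; _<_; _≥_)
open import Data.Bool using (Bool; true; false; if_then_else_)
open import Data.Maybe using (Maybe; just; nothing)
open import Data.Fin using (Fin)
open import Data.Vec using (Vec; lookup; zipWith; map)
open import Data.List using (List; length; filter; foldr; _++_)
import Data.List as L
open import Data.List.Membership.Propositional using (_∈_)
open import Data.List.Relation.Unary.Unique.Propositional using (Unique)
open import Data.List.Relation.Unary.AllPairs using (AllPairs)
open import Data.Fin.Subset using (Subset; ∁; _∩_; _∪_; ∣_∣; Empty) renaming (⊥ to ∅ˢ)
open import Data.Product using (Σ; ∃; _×_; _,_)
open import Data.Sum using (_⊎_)
open import Relation.Binary.PropositionalEquality using (_≡_)
open import Relation.Nullary.Decidable using (yes; no)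
import Data.Nat as ℕ

-- A partial function σ with dom(σ) ⊆ N = {0,…,N-1} and values in {0,1}:
-- lookup σ i = nothing means i ∉ dom(σ).
PF : ℕ → Set
PF N = Vec (Maybe Bool) N

module _ {N : ℕ} where

  dom : PF N → Subset N
  dom = map (λ { nothing → false ; (just _) → true })

  -- |σ| = cardinality of σ (as a set of pairs) = |dom σ|
  size : PF N → ℕ
  size σ = ∣ dom σ ∣

  _↾_ : PF N → Subset N → PF N
  σ ↾ Z = zipWith (λ z v → if z then v else nothing) Z σ

  _⊑_ : PF N → PF N → Set
  ρ ⊑ σ = ∀ (i : Fin N) (b : Bool) → lookup ρ i ≡ just b → lookup σ i ≡ just b

  -- Families δ ⊆ ^N 2 are represented by lists; the set is the set of members.
  Family : Set
  Family = List (PF N)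

  Lfam : Family → Subset N → Family
  Lfam δ Z = L.map (λ σ → σ ↾ Z)
               (filter (λ σ → size (σ ↾ (∁ Z)) ℕ.≤? size (σ ↾ Z)) δ)

  Rfam : Family → Subset N → Family
  Rfam δ Z = L.map (λ σ → σ ↾ (∁ Z))
               (filter (λ σ → size (σ ↾ Z) ℕ.<? size (σ ↾ (∁ Z))) δ)

  _⪯_ : Family → Family → Set
  δ₁ ⪯ δ₂ = ∀ σ → σ ∈ δ₁ → ∃ λ ρ → ρ ∈ δ₂ × ρ ⊑ σ

  _⊆ᶠ_ : Family → Family → Set
  δ' ⊆ᶠ δ = ∀ σ → σ ∈ δ' → σ ∈ δ

  domUnion : Family → Subset N
  domUnion = foldr (λ σ acc → dom σ ∪ acc) ∅ˢ

  -- k satisfies the defining property in hn(δ): every (finite, duplicate-free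
  -- list representing a) subfamily δ' ⊆ δ has a subfamily δ'' with pairwise
  -- disjoint domains covering at least k·|δ'| points.
  Good : Family → ℕ → Set
  Good δ k = ∀ (δ' : Family) → Unique δ' → δ' ⊆ᶠ δ →
    ∃ λ (δ'' : Family) → Unique δ'' × δ'' ⊆ᶠ δ' ×
      AllPairs (λ σ τ → Empty (dom σ ∩ dom τ)) δ'' ×
      k * length δ' ≤ ∣ domUnion δ'' ∣

  -- hn(δ) = h : h is the maximum of k+1 over k < N with Good δ k
  -- (convention: for N = 0 the range is empty and hn(δ) = 0).
  HnIs : Family → ℕ → Set
  HnIs δ h = (N ≡ 0 × h ≡ 0)
    ⊎ (∃ λ k → k < N × h ≡ suc k × Good δ k ×
         (∀ k' → k' < N → Good δ k' → k' ≤ k))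

  HNIs : Family → ℕ → Set
  HNIs δ h = (∃ λ δ' → δ ⪯ δ' × HnIs δ' h)
    × (∀ δ' h' → δ ⪯ δ' → HnIs δ' h' → h' ≤ h)

-- HN(δ) > k means that some refinement δ' of δ is good for k: every subfamily
-- of δ' has a subfamily with pairwise disjoint domains covering at least k times
-- its size. The members of L(δ,Z) live on Z and those of R(δ,Z) on N ∖ Z. A
-- refinement of a family living on Z can be cut down to its members living on Z,
-- and good families on Z and on N ∖ Z combine into a good family: split a
-- subfamily into its two halves and take a disjoint cover of each; the union is
-- still disjoint and the sizes of the covered sets add up. Conversely every
-- refinement of L ∪ R refines L and R. Hence HN(L ∪ R) > k iff HN(L) > k and
-- HN(R) > k, and as these conditions are downward closed in k, the maxima combine
-- into a minimum. Everything is finite, so the maxima are found by exhaustive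
-- search over the sublists of the list of all partial functions.

module Submission where

open import Defs
open import Data.Nat using (ℕ; _⊓_)
open import Data.Fin.Subset using (Subset)
open import Data.List using (_++_)
open import Data.Product using (∃; _×_)

open import Data.Nat using (zero; suc; _+_; _*_; _≤_; _<_; _≤?_; z≤n; s≤s)
open import Data.Nat.Properties
  using (≤-refl; ≤-trans; <⇒≤; +-mono-≤; ≤-pred; ≤-<-trans; +-suc;
         *-distribˡ-+; *-monoʳ-≤; *-monoˡ-≤; m<1+n⇒m<n∨m≡n; m⊓n≤m; m⊓n≤n; ⊓-glb; module ≤-Reasoning)
open import Data.Bool using (Bool; true; false)
open import Data.Maybe using (Maybe; just; nothing)
import Data.Maybe.Properties as Maybe
import Data.Bool.Properties as Bool
open import Data.Fin using (Fin; zero; suc)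
open import Data.Fin.Properties using (injective⇒≤; all?)
open import Data.Fin.Subset using (_⊆_; _∩_; _∪_; ∁; ∣_∣; Empty)
open import Data.Fin.Subset.Properties
  using (⊆-refl; out⊆; in⊆in; ∉⊥; p⊆p∪q; q⊆p∪q; x∈p∪q⁻; x∈p∩q⁻; x∈p∩q⁺; x∈∁p⇒x∉p; drop-∷-Empty;
         p⊆q⇒∣p∣≤∣q∣; ∪-identityˡ; ∪-assoc; nonempty?; _⊆?_)
open import Data.Vec using ([]; _∷_; here; lookup)
import Data.Vec.Properties as Vec
open import Data.List as List
  using (List; []; _∷_; length; filter; map; deduplicate; cartesianProductWith)
open import Data.List.Membership.Propositional using (_∈_; find; lose)
open import Data.List.Membership.Propositional.Properties
  using (∈-++⁺ˡ; ∈-++⁺ʳ; ∈-++⁻; ∈-map⁺; ∈-map⁻; ∈-filter⁺; ∈-filter⁻; ∈-lookup;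
         ∈-deduplicate⁺; ∈-cartesianProductWith⁺)
open import Data.List.Relation.Binary.Subset.Propositional using () renaming (_⊆_ to _⊆ˡ_)
open import Data.List.Relation.Unary.Any as Any using (Any; here; there; index)
open import Data.List.Relation.Unary.Any.Properties using (lookup-index)
open import Data.List.Relation.Unary.All as All using (All; []; _∷_)
open import Data.List.Relation.Unary.AllPairs using (AllPairs; []; _∷_; allPairs?)
import Data.List.Relation.Unary.AllPairs.Properties as AllPairs
open import Data.List.Relation.Unary.Unique.Propositional using (Unique)
import Data.List.Relation.Unary.Unique.Propositional.Properties as Unique
open import Data.List.Relation.Unary.Unique.DecPropositional.Properties using (deduplicate-!)
open import Data.Product using (_,_; proj₁; proj₂)
open import Data.Sum using (inj₁; inj₂)
open import Data.Empty using (⊥-elim)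
open import Function using (_∘_; Injective)
open import Relation.Binary.Core using (Rel)
open import Relation.Binary.Definitions using (Symmetric; DecidableEquality)
open import Relation.Binary.PropositionalEquality
  using (_≡_; _≢_; refl; sym; trans; cong; module ≡-Reasoning)
open import Relation.Nullary using (Dec; yes; no; ¬_; contradiction)
open import Relation.Nullary.Decidable using (map′; _×-dec_; ¬?)
open import Relation.Unary using (Pred; Decidable; _≐_) renaming (_∩_ to _∩ᵖ_)
open import Relation.Unary.Properties using (∁?)

module _ {A : Set} where

  sublists : List A → List (List A)
  sublists []       = [] ∷ []
  sublists (x ∷ xs) = map (x ∷_) (sublists xs) ++ sublists xs

  ∈-sublists⇒⊆ : ∀ xs {ys} → ys ∈ sublists xs → ys ⊆ˡ xs
  ∈-sublists⇒⊆ []       (here refl) ()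
  ∈-sublists⇒⊆ (x ∷ xs) ys∈ with ∈-++⁻ (map (x ∷_) (sublists xs)) ys∈
  ... | inj₂ ys∈′ = there ∘ ∈-sublists⇒⊆ xs ys∈′
  ... | inj₁ ys∈′ with ys , ys∈″ , refl ← ∈-map⁻ (x ∷_) ys∈′ = λ where
    (here refl) → here refl
    (there y∈)  → there (∈-sublists⇒⊆ xs ys∈″ y∈)

  Unique-sublists : ∀ {xs ys} → Unique xs → ys ∈ sublists xs → Unique ys
  Unique-sublists {[]}     []         (here refl) = []
  Unique-sublists {x ∷ xs} (x∉ ∷ xs!) ys∈ with ∈-++⁻ (map (x ∷_) (sublists xs)) ys∈
  ... | inj₂ ys∈′ = Unique-sublists xs! ys∈′
  ... | inj₁ ys∈′ with ys , ys∈″ , refl ← ∈-map⁻ (x ∷_) ys∈′ =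
    All.tabulate (All.lookup x∉ ∘ ∈-sublists⇒⊆ xs ys∈″) ∷ Unique-sublists xs! ys∈″

  filter∈sublists : ∀ {p} {P : Pred A p} (P? : Decidable P) xs → filter P? xs ∈ sublists xs
  filter∈sublists P? []       = here refl
  filter∈sublists P? (x ∷ xs) with P? x
  ... | yes _ = ∈-++⁺ˡ (∈-map⁺ (x ∷_) (filter∈sublists P? xs))
  ... | no  _ = ∈-++⁺ʳ (map (x ∷_) (sublists xs)) (filter∈sublists P? xs)

  length-filter+length-filter-∁ : ∀ {p} {P : Pred A p} (P? : Decidable P) xs →
    length (filter P? xs) + length (filter (∁? P?) xs) ≡ length xs
  length-filter+length-filter-∁ P? []       = refl
  length-filter+length-filter-∁ P? (x ∷ xs) with P? x
  ... | yes _ = cong suc (length-filter+length-filter-∁ P? xs)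
  ... | no  _ = trans (+-suc _ _) (cong suc (length-filter+length-filter-∁ P? xs))

  Unique⇒lookup-injective : ∀ {xs : List A} → Unique xs → Injective _≡_ _≡_ (List.lookup xs)
  Unique⇒lookup-injective (x∉ ∷ xs!) {zero}  {zero}  _  = refl
  Unique⇒lookup-injective (x∉ ∷ xs!) {zero}  {suc j} eq = contradiction eq (All.lookup x∉ (∈-lookup j))
  Unique⇒lookup-injective (x∉ ∷ xs!) {suc i} {zero}  eq = contradiction (sym eq) (All.lookup x∉ (∈-lookup i))
  Unique⇒lookup-injective (x∉ ∷ xs!) {suc i} {suc j} eq = cong suc (Unique⇒lookup-injective xs! eq)

  Unique⇒length-mono-⊆ : ∀ {xs ys : List A} → Unique xs → xs ⊆ˡ ys → length xs ≤ length ys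
  Unique⇒length-mono-⊆ {xs} {ys} xs! xs⊆ys = injective⇒≤ position-injective
    where
    position : Fin (length xs) → Fin (length ys)
    position i = index (xs⊆ys (∈-lookup i))

    position-injective : Injective _≡_ _≡_ position
    position-injective {i} {j} eq = Unique⇒lookup-injective xs! (begin
      List.lookup xs i             ≡⟨ lookup-index (xs⊆ys (∈-lookup i)) ⟩
      List.lookup ys (position i)  ≡⟨ cong (List.lookup ys) eq ⟩
      List.lookup ys (position j)  ≡⟨ lookup-index (xs⊆ys (∈-lookup j)) ⟨
      List.lookup xs j             ∎)
      where open ≡-Reasoning

  module _ {r} {R : Rel A r} (R-sym : Symmetric R) where

    AllPairs-∈ : ∀ {xs x y} → AllPairs R xs → x ∈ xs → y ∈ xs → x ≢ y → R x y
    AllPairs-∈ (Rx ∷ _)  (here refl) (here refl) x≢y = contradiction refl x≢y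
    AllPairs-∈ (Rx ∷ _)  (here refl) (there y∈)  _   = All.lookup Rx y∈
    AllPairs-∈ (Rx ∷ _)  (there x∈)  (here refl) _   = R-sym (All.lookup Rx x∈)
    AllPairs-∈ (_ ∷ Rxs) (there x∈)  (there y∈)  x≢y = AllPairs-∈ Rxs x∈ y∈ x≢y

    AllPairs-⊆ : ∀ {xs ys} → AllPairs R ys → Unique xs → xs ⊆ˡ ys → AllPairs R xs
    AllPairs-⊆ Rys []         _     = []
    AllPairs-⊆ Rys (x∉ ∷ xs!) xs⊆ys =
      All.tabulate (λ y∈ → AllPairs-∈ Rys (xs⊆ys (here refl)) (xs⊆ys (there y∈)) (All.lookup x∉ y∈))
      ∷ AllPairs-⊆ Rys xs! (xs⊆ys ∘ there)

IsLargestBelow : ∀ {p} → Pred ℕ p → ℕ → ℕ → Set p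
IsLargestBelow P n k = k < n × P k × (∀ {j} → j < n → P j → j ≤ k)

largestBelow : ∀ {p} {P : Pred ℕ p} → Decidable P → P 0 → ∀ n → ∃ (IsLargestBelow P (suc n))
largestBelow P? P0 zero = 0 , s≤s z≤n , P0 , λ { (s≤s z≤n) _ → z≤n }
largestBelow {P = P} P? P0 (suc n) with P? (suc n) | largestBelow P? P0 n
... | yes Pn | _ = suc n , ≤-refl , Pn , λ j<n _ → ≤-pred j<n
... | no ¬Pn | k , k<n , Pk , largest = k , s≤s (<⇒≤ k<n) , Pk , largest′
  where
  largest′ : ∀ {j} → j < suc (suc n) → P j → j ≤ k
  largest′ j<n Pj with m<1+n⇒m<n∨m≡n j<n
  ... | inj₁ j<n′ = largest j<n′ Pj
  ... | inj₂ refl = contradiction Pj ¬Pn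

module _ {p q r} {P : Pred ℕ p} {Q : Pred ℕ q} {R : Pred ℕ r}
         (Q-down : ∀ {i j} → j ≤ i → Q i → Q j) (R-down : ∀ {i j} → j ≤ i → R i → R j)
         (P≐Q∩R : P ≐ Q ∩ᵖ R) where

  IsLargestBelow-⊓ : ∀ {n a b} → IsLargestBelow Q n a → IsLargestBelow R n b →
    IsLargestBelow P n (a ⊓ b)
  IsLargestBelow-⊓ {a = a} {b} (a<n , Qa , a-largest) (_ , Rb , b-largest) =
    ≤-<-trans (m⊓n≤m a b) a<n ,
    proj₂ P≐Q∩R (Q-down (m⊓n≤m a b) Qa , R-down (m⊓n≤n a b) Rb) ,
    λ j<n Pj → ⊓-glb (a-largest j<n (proj₁ (proj₁ P≐Q∩R Pj))) (b-largest j<n (proj₂ (proj₁ P≐Q∩R Pj)))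

Empty-∩-separated : ∀ {n} {p q Z : Subset n} → p ⊆ Z → q ⊆ ∁ Z → Empty (p ∩ q)
Empty-∩-separated {p = p} {q} p⊆Z q⊆∁Z (x , x∈p∩q) with x∈p , x∈q ← x∈p∩q⁻ p q x∈p∩q =
  x∈∁p⇒x∉p (q⊆∁Z x∈q) (p⊆Z x∈p)

∣p∪q∣≡∣p∣+∣q∣ : ∀ {n} (p q : Subset n) → Empty (p ∩ q) → ∣ p ∪ q ∣ ≡ ∣ p ∣ + ∣ q ∣
∣p∪q∣≡∣p∣+∣q∣ []          []          _         = refl
∣p∪q∣≡∣p∣+∣q∣ (true  ∷ p) (true  ∷ q) p∩q-empty = contradiction (zero , here) p∩q-empty
∣p∪q∣≡∣p∣+∣q∣ (true  ∷ p) (false ∷ q) p∩q-empty = cong suc (∣p∪q∣≡∣p∣+∣q∣ p q (drop-∷-Empty p∩q-empty))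
∣p∪q∣≡∣p∣+∣q∣ (false ∷ p) (true  ∷ q) p∩q-empty =
  trans (cong suc (∣p∪q∣≡∣p∣+∣q∣ p q (drop-∷-Empty p∩q-empty))) (sym (+-suc ∣ p ∣ ∣ q ∣))
∣p∪q∣≡∣p∣+∣q∣ (false ∷ p) (false ∷ q) p∩q-empty = ∣p∪q∣≡∣p∣+∣q∣ p q (drop-∷-Empty p∩q-empty)

dom-↾ : ∀ {n} (σ : PF n) Z → dom (σ ↾ Z) ⊆ Z
dom-↾ []            []          = ⊆-refl
dom-↾ (_ ∷ σ)       (false ∷ Z) = out⊆ (dom-↾ σ Z)
dom-↾ (nothing ∷ σ) (true ∷ Z)  = out⊆ (dom-↾ σ Z)
dom-↾ (just _ ∷ σ)  (true ∷ Z)  = in⊆in (dom-↾ σ Z)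

⊑-dom : ∀ {n} {ρ σ : PF n} → ρ ⊑ σ → dom ρ ⊆ dom σ
⊑-dom {ρ = []}         {[]}    _   = ⊆-refl
⊑-dom {ρ = nothing ∷ _} {_ ∷ _} ρ⊑σ = out⊆ (⊑-dom (ρ⊑σ ∘ suc))
⊑-dom {ρ = just b ∷ _}  {_ ∷ _} ρ⊑σ with refl ← ρ⊑σ zero b refl = in⊆in (⊑-dom (ρ⊑σ ∘ suc))

allPF : ∀ n → List (PF n)
allPF zero    = [] ∷ []
allPF (suc n) = cartesianProductWith _∷_ (nothing ∷ just false ∷ just true ∷ []) (allPF n)

∈-allPF : ∀ {n} (σ : PF n) → σ ∈ allPF n
∈-allPF []      = here refl
∈-allPF (v ∷ σ) = ∈-cartesianProductWith⁺ _∷_ (∈-values v) (∈-allPF σ)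
  where
  ∈-values : ∀ v → v ∈ nothing ∷ just false ∷ just true ∷ []
  ∈-values nothing      = here refl
  ∈-values (just false) = there (here refl)
  ∈-values (just true)  = there (there (here refl))

pointwise-⊑? : (a c : Maybe Bool) → Dec (∀ b → a ≡ just b → c ≡ just b)
pointwise-⊑? nothing  c = yes λ _ ()
pointwise-⊑? (just b) c with Maybe.≡-dec Bool._≟_ c (just b)
... | yes c≡b = yes λ { _ refl → c≡b }
... | no  c≢b = no λ a⊑c → c≢b (a⊑c b refl)

_⊑?_ : ∀ {n} (ρ σ : PF n) → Dec (ρ ⊑ σ)
ρ ⊑? σ = all? λ i → pointwise-⊑? (lookup ρ i) (lookup σ i)

module _ {N : ℕ} where

  Disjoint : PF N → PF N → Set
  Disjoint σ τ = Empty (dom σ ∩ dom τ)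

  Disjoint-sym : Symmetric Disjoint
  Disjoint-sym {σ} {τ} σ#τ (x , x∈τ∩σ) with x∈τ , x∈σ ← x∈p∩q⁻ (dom τ) (dom σ) x∈τ∩σ =
    σ#τ (x , x∈p∩q⁺ (x∈σ , x∈τ))

  SupportedOn : Family {N} → Subset N → Set
  SupportedOn δ Z = ∀ σ → σ ∈ δ → dom σ ⊆ Z

  map-↾-SupportedOn : ∀ Z (δ : Family {N}) → SupportedOn (map (_↾ Z) δ) Z
  map-↾-SupportedOn Z δ σ σ∈ with τ , _ , refl ← ∈-map⁻ (_↾ Z) σ∈ = dom-↾ τ Z

  dom⊆domUnion : ∀ {σ} {δ : Family {N}} → σ ∈ δ → dom σ ⊆ domUnion δ
  dom⊆domUnion {δ = _ ∷ δ} (here refl) = p⊆p∪q (domUnion δ)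
  dom⊆domUnion {δ = τ ∷ δ} (there σ∈)  = q⊆p∪q (dom τ) (domUnion δ) ∘ dom⊆domUnion σ∈

  domUnion-⊆ : ∀ {δ : Family {N}} {Z} → SupportedOn δ Z → domUnion δ ⊆ Z
  domUnion-⊆ {[]}    _    x∈ = ⊥-elim (∉⊥ x∈)
  domUnion-⊆ {σ ∷ δ} δ-on-Z x∈ with x∈p∪q⁻ (dom σ) (domUnion δ) x∈
  ... | inj₁ x∈σ = δ-on-Z σ (here refl) x∈σ
  ... | inj₂ x∈δ = domUnion-⊆ (λ τ τ∈ → δ-on-Z τ (there τ∈)) x∈δ

  domUnion-mono : ∀ {δ δ' : Family {N}} → δ ⊆ᶠ δ' → domUnion δ ⊆ domUnion δ'
  domUnion-mono δ⊆δ' = domUnion-⊆ (λ σ σ∈ → dom⊆domUnion (δ⊆δ' σ σ∈))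

  domUnion-++ : ∀ (δ δ' : Family {N}) → domUnion (δ ++ δ') ≡ domUnion δ ∪ domUnion δ'
  domUnion-++ []      δ' = sym (∪-identityˡ (domUnion δ'))
  domUnion-++ (σ ∷ δ) δ' =
    trans (cong (dom σ ∪_) (domUnion-++ δ δ')) (sym (∪-assoc (dom σ) (domUnion δ) (domUnion δ')))

  _≟ᴾ_ : DecidableEquality (PF N)
  _≟ᴾ_ = Vec.≡-dec (Maybe.≡-dec Bool._≟_)

  open import Data.List.Membership.DecPropositional _≟ᴾ_ using (_∈?_)

  filter-∈-⊆ : ∀ (X D : Family {N}) → filter (_∈? X) D ⊆ᶠ X
  filter-∈-⊆ X D σ σ∈ = proj₂ (∈-filter⁻ (_∈? X) {xs = D} σ∈)

  filter-∉-⊆ : ∀ (X Y D : Family {N}) → D ⊆ᶠ (X ++ Y) → filter (∁? (_∈? X)) D ⊆ᶠ Y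
  filter-∉-⊆ X Y D D⊆X++Y σ σ∈ with σ∈D , σ∉X ← ∈-filter⁻ (∁? (_∈? X)) {xs = D} σ∈
    with ∈-++⁻ X (D⊆X++Y σ σ∈D)
  ... | inj₁ σ∈X = contradiction σ∈X σ∉X
  ... | inj₂ σ∈Y = σ∈Y

  Good-antitone : ∀ {δ δ' : Family {N}} {k} → δ ⊆ᶠ δ' → Good δ' k → Good δ k
  Good-antitone δ⊆δ' Gδ' D D! D⊆δ = Gδ' D D! (λ σ σ∈ → δ⊆δ' σ (D⊆δ σ σ∈))

  Good-downward : ∀ {δ : Family {N}} {j k} → j ≤ k → Good δ k → Good δ j
  Good-downward j≤k Gδ D D! D⊆δ with C , C! , C⊆D , C-disjoint , C-big ← Gδ D D! D⊆δ =
    C , C! , C⊆D , C-disjoint , ≤-trans (*-monoˡ-≤ (length D) j≤k) C-big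

  Good-zero : ∀ (δ : Family {N}) → Good δ 0
  Good-zero δ _ _ _ = [] , [] , (λ _ ()) , [] , z≤n

  Good-++-separated : ∀ {X Y : Family {N}} {Z k} → SupportedOn X Z → SupportedOn Y (∁ Z) →
    Good X k → Good Y k → Good (X ++ Y) k
  Good-++-separated {X} {Y} {Z} {k} X-on-Z Y-on-∁Z GX GY D D! D⊆X++Y
    with A , A! , A⊆DX , A-disjoint , A-big ←
           GX (filter (_∈? X) D) (Unique.filter⁺ (_∈? X) D!) (filter-∈-⊆ X D)
       | B , B! , B⊆DY , B-disjoint , B-big ←
           GY (filter (∁? (_∈? X)) D) (Unique.filter⁺ (∁? (_∈? X)) D!) (filter-∉-⊆ X Y D D⊆X++Y)
    = A ++ B , Unique.++⁺ A! B! A∩B-empty , A++B⊆D , A++B-disjoint , A++B-big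
    where
    DX = filter (_∈? X) D
    DY = filter (∁? (_∈? X)) D

    A⊆X : A ⊆ᶠ X
    A⊆X σ σ∈ = filter-∈-⊆ X D σ (A⊆DX σ σ∈)

    B⊆Y : B ⊆ᶠ Y
    B⊆Y σ σ∈ = filter-∉-⊆ X Y D D⊆X++Y σ (B⊆DY σ σ∈)

    A-on-Z : SupportedOn A Z
    A-on-Z σ σ∈ = X-on-Z σ (A⊆X σ σ∈)

    B-on-∁Z : SupportedOn B (∁ Z)
    B-on-∁Z σ σ∈ = Y-on-∁Z σ (B⊆Y σ σ∈)

    A∩B-empty : ∀ {σ} → ¬ (σ ∈ A × σ ∈ B)
    A∩B-empty {σ} (σ∈A , σ∈B) = proj₂ (∈-filter⁻ (∁? (_∈? X)) {xs = D} (B⊆DY σ σ∈B)) (A⊆X σ σ∈A)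

    A++B⊆D : (A ++ B) ⊆ᶠ D
    A++B⊆D σ σ∈ with ∈-++⁻ A σ∈
    ... | inj₁ σ∈A = proj₁ (∈-filter⁻ (_∈? X) {xs = D} (A⊆DX σ σ∈A))
    ... | inj₂ σ∈B = proj₁ (∈-filter⁻ (∁? (_∈? X)) {xs = D} (B⊆DY σ σ∈B))

    A++B-disjoint : AllPairs Disjoint (A ++ B)
    A++B-disjoint = AllPairs.++⁺ A-disjoint B-disjoint
      (All.tabulate λ {σ} σ∈A → All.tabulate λ {τ} τ∈B →
        Empty-∩-separated (A-on-Z σ σ∈A) (B-on-∁Z τ τ∈B))

    domUnions-disjoint : Empty (domUnion A ∩ domUnion B)
    domUnions-disjoint = Empty-∩-separated (domUnion-⊆ A-on-Z) (domUnion-⊆ B-on-∁Z)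

    A++B-big : k * length D ≤ ∣ domUnion (A ++ B) ∣
    A++B-big = begin
      k * length D                   ≡⟨ cong (k *_) (length-filter+length-filter-∁ (_∈? X) D) ⟨
      k * (length DX + length DY)    ≡⟨ *-distribˡ-+ k (length DX) (length DY) ⟩
      k * length DX + k * length DY  ≤⟨ +-mono-≤ A-big B-big ⟩
      ∣ domUnion A ∣ + ∣ domUnion B ∣  ≡⟨ ∣p∪q∣≡∣p∣+∣q∣ (domUnion A) (domUnion B) domUnions-disjoint ⟨
      ∣ domUnion A ∪ domUnion B ∣    ≡⟨ cong ∣_∣ (domUnion-++ A B) ⟨
      ∣ domUnion (A ++ B) ∣          ∎
      where open ≤-Reasoning

  ⪯-refl : ∀ {δ : Family {N}} → δ ⪯ δ
  ⪯-refl σ σ∈ = σ , σ∈ , λ _ _ eq → eq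

  ⊆ᶠ-⪯-trans : ∀ {δ δ' δ'' : Family {N}} → δ ⊆ᶠ δ' → δ' ⪯ δ'' → δ ⪯ δ''
  ⊆ᶠ-⪯-trans δ⊆δ' δ'⪯δ'' σ σ∈ = δ'⪯δ'' σ (δ⊆δ' σ σ∈)

  ⪯-⊆ᶠ-trans : ∀ {δ δ' δ'' : Family {N}} → δ ⪯ δ' → δ' ⊆ᶠ δ'' → δ ⪯ δ''
  ⪯-⊆ᶠ-trans δ⪯δ' δ'⊆δ'' σ σ∈ with ρ , ρ∈ , ρ⊑σ ← δ⪯δ' σ σ∈ = ρ , δ'⊆δ'' ρ ρ∈ , ρ⊑σ

  ⪯-++ : ∀ {X X' Y Y' : Family {N}} → X ⪯ X' → Y ⪯ Y' → (X ++ Y) ⪯ (X' ++ Y')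
  ⪯-++ {X} {X'} X⪯X' Y⪯Y' σ σ∈ with ∈-++⁻ X σ∈
  ... | inj₁ σ∈X with ρ , ρ∈ , ρ⊑σ ← X⪯X' σ σ∈X = ρ , ∈-++⁺ˡ ρ∈ , ρ⊑σ
  ... | inj₂ σ∈Y with ρ , ρ∈ , ρ⊑σ ← Y⪯Y' σ σ∈Y = ρ , ∈-++⁺ʳ X' ρ∈ , ρ⊑σ

  filterSupportedOn : Subset N → Family {N} → Family {N}
  filterSupportedOn Z = filter (λ ρ → dom ρ ⊆? Z)

  filterSupportedOn-SupportedOn : ∀ Z δ → SupportedOn (filterSupportedOn Z δ) Z
  filterSupportedOn-SupportedOn Z δ ρ ρ∈ = proj₂ (∈-filter⁻ (λ ρ → dom ρ ⊆? Z) {xs = δ} ρ∈)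

  filterSupportedOn-⊆ : ∀ Z δ → filterSupportedOn Z δ ⊆ᶠ δ
  filterSupportedOn-⊆ Z δ ρ ρ∈ = proj₁ (∈-filter⁻ (λ ρ → dom ρ ⊆? Z) {xs = δ} ρ∈)

  ⪯-filterSupportedOn : ∀ {X δ Z} → SupportedOn X Z → X ⪯ δ → X ⪯ filterSupportedOn Z δ
  ⪯-filterSupportedOn {Z = Z} X-on-Z X⪯δ σ σ∈ with ρ , ρ∈ , ρ⊑σ ← X⪯δ σ σ∈ =
    ρ , ∈-filter⁺ (λ ρ → dom ρ ⊆? Z) ρ∈ (X-on-Z σ σ∈ ∘ ⊑-dom ρ⊑σ) , ρ⊑σ

  HasGoodRefinement : Family {N} → ℕ → Set
  HasGoodRefinement δ k = ∃ λ δ' → δ ⪯ δ' × Good δ' k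

  HasGoodRefinement-zero : ∀ δ → HasGoodRefinement δ 0
  HasGoodRefinement-zero δ = δ , ⪯-refl , Good-zero δ

  HasGoodRefinement-downward : ∀ {δ j k} → j ≤ k → HasGoodRefinement δ k → HasGoodRefinement δ j
  HasGoodRefinement-downward j≤k (δ' , δ⪯δ' , Gδ') = δ' , δ⪯δ' , Good-downward j≤k Gδ'

  HasGoodRefinement-antitone : ∀ {δ δ' k} → δ ⊆ᶠ δ' → HasGoodRefinement δ' k → HasGoodRefinement δ k
  HasGoodRefinement-antitone δ⊆δ' (δ'' , δ'⪯δ'' , Gδ'') = δ'' , ⊆ᶠ-⪯-trans δ⊆δ' δ'⪯δ'' , Gδ''

  HasGoodRefinement-++-separated : ∀ {X Y Z} → SupportedOn X Z → SupportedOn Y (∁ Z) →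
    HasGoodRefinement (X ++ Y) ≐ HasGoodRefinement X ∩ᵖ HasGoodRefinement Y
  HasGoodRefinement-++-separated {X} {Y} {Z} X-on-Z Y-on-∁Z =
    (λ {k} XY-good → HasGoodRefinement-antitone {k = k} (λ _ → ∈-++⁺ˡ) XY-good ,
                     HasGoodRefinement-antitone {k = k} (λ _ → ∈-++⁺ʳ X) XY-good) ,
    λ { {k} ((X' , X⪯X' , GX') , (Y' , Y⪯Y' , GY')) →
        filterSupportedOn Z X' ++ filterSupportedOn (∁ Z) Y' ,
        ⪯-++ (⪯-filterSupportedOn X-on-Z X⪯X') (⪯-filterSupportedOn Y-on-∁Z Y⪯Y') ,
        Good-++-separated {k = k}
          (filterSupportedOn-SupportedOn Z X') (filterSupportedOn-SupportedOn (∁ Z) Y')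
          (Good-antitone {k = k} (filterSupportedOn-⊆ Z X') GX')
          (Good-antitone {k = k} (filterSupportedOn-⊆ (∁ Z) Y') GY') }

  _⪯?_ : ∀ (δ δ' : Family {N}) → Dec (δ ⪯ δ')
  δ ⪯? δ' = map′ (λ refined σ σ∈ → find (All.lookup refined σ∈))
                 (λ δ⪯δ' → All.tabulate λ {σ} σ∈ → let ρ , ρ∈ , ρ⊑σ = δ⪯δ' σ σ∈ in lose ρ∈ ρ⊑σ)
                 (All.all? (λ σ → Any.any? (_⊑? σ) δ') δ)

  universe : List (PF N)
  universe = deduplicate _≟ᴾ_ (allPF N)

  ∈-universe : ∀ σ → σ ∈ universe
  ∈-universe σ = ∈-deduplicate⁺ _≟ᴾ_ (∈-allPF σ)

  universe-Unique : Unique universe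
  universe-Unique = deduplicate-! _≟ᴾ_ (allPF N)

  DisjointCover : ℕ → Family {N} → Family {N} → Set
  DisjointCover k D C = AllPairs Disjoint C × k * length D ≤ ∣ domUnion C ∣

  DisjointCover? : ∀ k D C → Dec (DisjointCover k D C)
  DisjointCover? k D C =
    allPairs? (λ σ τ → ¬? (nonempty? (dom σ ∩ dom τ))) C ×-dec (k * length D ≤? ∣ domUnion C ∣)

  -- Good X k only depends on the members of the subfamilies it quantifies over, so for a
  -- duplicate-free X it may range over the sublists of X instead; this makes it decidable.
  GoodOnSublists : Family {N} → ℕ → Set
  GoodOnSublists X k = All (λ D → Any (DisjointCover k D) (sublists D)) (sublists X)

  GoodOnSublists? : ∀ X k → Dec (GoodOnSublists X k)
  GoodOnSublists? X k = All.all? (λ D → Any.any? (DisjointCover? k D) (sublists D)) (sublists X)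

  Good⇒GoodOnSublists : ∀ {X k} → Unique X → Good X k → GoodOnSublists X k
  Good⇒GoodOnSublists {X} {k} X! GX = All.tabulate cover
    where
    cover : ∀ {D} → D ∈ sublists X → Any (DisjointCover k D) (sublists D)
    cover {D} D∈
      with C , C! , C⊆D , C-disjoint , C-big ← GX D (Unique-sublists X! D∈) (λ _ → ∈-sublists⇒⊆ X D∈) =
      lose (filter∈sublists (_∈? C) D)
        ( AllPairs-⊆ Disjoint-sym C-disjoint (Unique.filter⁺ (_∈? C) (Unique-sublists X! D∈))
            (λ {σ} → filter-∈-⊆ C D σ)
        , ≤-trans C-big (p⊆q⇒∣p∣≤∣q∣ (domUnion-mono λ σ σ∈C → ∈-filter⁺ (_∈? C) (C⊆D σ σ∈C) σ∈C)))

  GoodOnSublists⇒Good : ∀ {X k} → Unique X → GoodOnSublists X k → Good X k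
  GoodOnSublists⇒Good {X} {k} X! GX D D! D⊆X
    with C , C∈ , C-disjoint , C-big ← find (All.lookup GX (filter∈sublists (_∈? D) X)) =
    C , Unique-sublists (Unique.filter⁺ (_∈? D) X!) C∈ ,
    (λ σ σ∈C → filter-∈-⊆ D X σ (∈-sublists⇒⊆ _ C∈ σ∈C)) , C-disjoint ,
    ≤-trans (*-monoʳ-≤ k (Unique⇒length-mono-⊆ D! λ {σ} σ∈D → ∈-filter⁺ (_∈? D) (D⊆X σ σ∈D) σ∈D)) C-big

  HasGoodRefinement? : ∀ δ k → Dec (HasGoodRefinement δ k)
  HasGoodRefinement? δ k =
    map′ fromSearch toSearch (Any.any? (λ δ' → (δ ⪯? δ') ×-dec GoodOnSublists? δ' k) (sublists universe))
    where
    GoodRefinement : Family {N} → Set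
    GoodRefinement δ' = δ ⪯ δ' × GoodOnSublists δ' k

    fromSearch : Any GoodRefinement (sublists universe) → HasGoodRefinement δ k
    fromSearch found with δ' , δ'∈ , δ⪯δ' , Gδ' ← find found =
      δ' , δ⪯δ' , GoodOnSublists⇒Good {k = k} (Unique-sublists universe-Unique δ'∈) Gδ'

    toSearch : HasGoodRefinement δ k → Any GoodRefinement (sublists universe)
    toSearch (δ' , δ⪯δ' , Gδ') =
      lose (filter∈sublists (_∈? δ') universe)
        ( ⪯-⊆ᶠ-trans δ⪯δ' (λ ρ ρ∈ → ∈-filter⁺ (_∈? δ') (∈-universe ρ) ρ∈)
        , Good⇒GoodOnSublists {k = k} (Unique.filter⁺ (_∈? δ') universe-Unique)
            (Good-antitone {k = k} (filter-∈-⊆ δ' universe) Gδ'))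

  HNIs-suc : ∀ {δ k} → IsLargestBelow (HasGoodRefinement δ) N k → HNIs δ (suc k)
  HNIs-suc {δ} {k} (k<N , (δ' , δ⪯δ' , Gδ') , largest) =
    (δ' , δ⪯δ' , inj₂ (k , k<N , refl , Gδ' , λ j j<N Gj → largest j<N (δ' , δ⪯δ' , Gj))) ,
    bounded
    where
    bounded : ∀ δ'' h → δ ⪯ δ'' → HnIs δ'' h → h ≤ suc k
    bounded _   _ _      (inj₁ (_ , refl))                = z≤n
    bounded δ'' _ δ⪯δ'' (inj₂ (j , j<N , refl , Gj , _)) = s≤s (largest j<N (δ'' , δ⪯δ'' , Gj))

largestGoodRefinement : ∀ {M} (δ : Family {suc M}) → ∃ (IsLargestBelow (HasGoodRefinement δ) (suc M))
largestGoodRefinement δ = largestBelow (HasGoodRefinement? δ) (HasGoodRefinement-zero δ) _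

HNIs-zero : ∀ (δ : Family {0}) → HNIs δ 0
HNIs-zero δ = (δ , ⪯-refl , inj₁ (refl , refl)) , λ where
  _ _ _ (inj₁ (_ , refl))   → z≤n
  _ _ _ (inj₂ (_ , () , _))

mainTheorem15 : (N : ℕ) (δ : Family {N}) (Z : Subset N) →
    ∃ λ hL → ∃ λ hR → HNIs (Lfam δ Z) hL × HNIs (Rfam δ Z) hR ×
      HNIs (Lfam δ Z ++ Rfam δ Z) (hL ⊓ hR)
mainTheorem15 zero    δ Z = 0 , 0 , HNIs-zero _ , HNIs-zero _ , HNIs-zero _
mainTheorem15 (suc M) δ Z
  with kL , L-largest ← largestGoodRefinement (Lfam δ Z)
     | kR , R-largest ← largestGoodRefinement (Rfam δ Z) =
  suc kL , suc kR , HNIs-suc L-largest , HNIs-suc R-largest ,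
  HNIs-suc (IsLargestBelow-⊓ HasGoodRefinement-downward HasGoodRefinement-downward
             (HasGoodRefinement-++-separated (map-↾-SupportedOn Z _) (map-↾-SupportedOn (∁ Z) _))
             L-largest R-largest)
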